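{- Let $x,n_1,\dots,n_S$ be natural numbers such that there exists a ground term of weight $x$ with contents $(n_1,\dots,n_S)$, suppose $n_1+\dots+n_F\ge N$, and suppose at least two of the numbers $n_{B+1},\dots,n_F$ are positive. Then there exist at least $N$ different ground terms with contents $(n_1,\dots,n_S)$.
   Context: $\Sigma$ is a fixed finite signature with at least one constant and a fixed weight function $w:\Sigma\to\mathbb{N}$ ($w(a)>0$ for constants, at most one unary symbol of weight 0); weight of ground terms: $|c|=w(c)$, $|g(t_1,\dots,t_n)|=w(g)+\sum|t_i|$. The symbols of $\Sigma$ are enumerated $g_1,\dots,g_S$ so that $g_1,\dots,g_B$ are exactly the symbols of arity $\ge 2$ and $g_1,\dots,g_F$ are exactly the non-constant symbols (so $g_{B+1},\dots,g_F$ are the unary symbols). The contents of a ground term is $(n_1,\dots,n_S)$ with $n_i$ the number of occurrences of $g_i$ in it. -}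

module Defs where

open import Data.Nat using (ℕ; zero; suc; _+_; _≤_; _<_; _<?_)
open import Data.Fin using (Fin; toℕ; _≟_)
open import Data.Bool using (if_then_else_)
open import Relation.Nullary.Decidable using (⌊_⌋)
open import Data.Vec using (Vec; []; _∷_)
open import Data.List using (List; filter; map; allFin)
open import Data.Nat.ListAction using (sum)
open import Relation.Binary.PropositionalEquality using (_≡_)

-- A fixed finite signature Σ = {g_1,…,g_S} (indexed by Fin S) with weights,
-- enumerated so that g_1..g_B have arity ≥ 2, g_{B+1}..g_F are unary,
-- g_{F+1}..g_S are constants (indices are 0-based: g_{k+1} ↔ toℕ i = k).
record Signature : Set where
  field
    S B F  : ℕ
    arity  : Fin S → ℕ
    w      : Fin S → ℕ
    B≤F    : B ≤ F
    F<S    : F < S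
    ar-big   : ∀ i → toℕ i < B → 2 ≤ arity i
    ar-unary : ∀ i → B ≤ toℕ i → toℕ i < F → arity i ≡ 1
    ar-const : ∀ i → F ≤ toℕ i → arity i ≡ 0
    w-const  : ∀ i → arity i ≡ 0 → 0 < w i
    w-unary  : ∀ i j → arity i ≡ 1 → arity j ≡ 1 → w i ≡ 0 → w j ≡ 0 → i ≡ j

open Signature public

data Term (Σ : Signature) : Set where
  app : (i : Fin (S Σ)) → Vec (Term Σ) (arity Σ i) → Term Σ

module _ {Σ : Signature} where
  mutual
    weight : Term Σ → ℕ
    weight (app i ts) = w Σ i + weights ts

    weights : ∀ {k} → Vec (Term Σ) k → ℕ
    weights []       = 0
    weights (t ∷ ts) = weight t + weights ts

  mutual
    occ : Fin (S Σ) → Term Σ → ℕ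
    occ j (app i ts) = (if ⌊ j ≟ i ⌋ then 1 else 0) + occs j ts

    occs : ∀ {k} → Fin (S Σ) → Vec (Term Σ) k → ℕ
    occs j []       = 0
    occs j (t ∷ ts) = occ j t + occs j ts


  HasContents : Term Σ → (Fin (S Σ) → ℕ) → Set
  HasContents t n = ∀ j → occ j t ≡ n j

sumNonConst : (Σ : Signature) → (Fin (S Σ) → ℕ) → ℕ
sumNonConst Σ n = sum (map n (filter (λ i → toℕ i <? F Σ) (allFin (S Σ))))

{-# OPTIONS --safe #-}
module Submission where

-- Cutting every non-constant node g(t₁, …, tₖ) of t away from its first argument splits t into its
-- leftmost constant and one piece g(□, c₂, …, cₖ) per occurrence of a non-constant symbol, the cᵢ being
-- the leftmost constants of the tᵢ. Plugging the pieces into each other through the hole, in any order,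
-- and finally the leftmost constant gives a left comb with the same contents as t, whose left spine
-- lists the symbols of the pieces in that order. Say a ≥ 1 pieces carry the symbol i and r ≥ 1 pieces
-- (the j-pieces among them) carry other symbols. Putting the block of non-i pieces after the first k
-- i-pieces (1 ≤ k ≤ a), or the block of i-pieces after the first k non-i pieces (1 ≤ k ≤ r), gives
-- a + r combs, told apart by the lengths of the leading run of i and of non-i on their spines; and
-- a + r = n₁ + ⋯ + n_F ≥ N.

open import Defs
open import Data.Bool using (if_then_else_)
open import Data.Fin using (Fin; toℕ; _≟_; splitAt; join; inject≤)
open import Data.Fin.Properties using (toℕ-injective; toℕ≤pred[n]; inject≤-injective; join-splitAt)
open import Data.List using (List; []; _∷_; _++_; map; filter; foldr; take; drop; takeWhile; length; allFin)
open import Data.List.Properties using (map-++; ++-assoc; length-++; length-map; length-take; take++drop≡id)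
open import Data.List.Relation.Unary.All using (All; []; _∷_)
import Data.List.Relation.Unary.All as All
open import Data.List.Relation.Unary.All.Properties using (all-filter; take⁺) renaming (map⁺ to All-map⁺)
open import Data.List.Relation.Unary.AllPairs using (_∷_)
open import Data.List.Relation.Unary.Unique.Propositional using (Unique)
import Data.List.Relation.Unary.Unique.Propositional.Properties as Unique
open import Data.List.Relation.Binary.Permutation.Propositional
  using (_↭_; ↭-refl; ↭-trans; prep; module PermutationReasoning)
open import Data.List.Relation.Binary.Permutation.Propositional.Properties
  using (shift; ++-comm; ++⁺ˡ; ↭-length; map⁺)
open import Data.List.Relation.Binary.Sublist.Propositional using (⊆-refl)
import Data.List.Relation.Binary.Sublist.Propositional.Properties as Sublist
open import Data.Nat using (ℕ; suc; _+_; _≤_; _<_; z≤n; s≤s; _<?_)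
open import Data.Nat.ListAction using (sum)
open import Data.Nat.ListAction.Properties using (sum-++; sum-↭)
open import Data.Nat.Properties
  using (suc-injective; ≤-trans; ≤-reflexive; +-mono-≤; +-identityʳ; <⇒≢; ≮⇒≥; m≤n⇒m⊓n≡m;
         +-commutativeSemigroup; module ≤-Reasoning)
open import Algebra.Properties.CommutativeSemigroup +-commutativeSemigroup
  using (interchange; x∙yz≈y∙xz; x∙yz≈xz∙y)
open import Data.Nat.Tactic.RingSolver using (solve-∀)
open import Data.Product using (Σ-syntax; _×_; ∃-syntax; _,_; proj₁; proj₂)
open import Data.Sum using (_⊎_; inj₁; inj₂)
open import Data.Vec using (Vec; []; _∷_)
open import Function using (_∘_)
open import Function.Definitions using (Injective)
open import Relation.Binary.Definitions using (DecidableEquality)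
open import Relation.Binary.PropositionalEquality
  using (_≡_; _≢_; refl; sym; trans; cong; cong₂; subst; module ≡-Reasoning)
open import Relation.Nullary using (¬_; Dec; yes; no; contradiction)
open import Relation.Nullary.Decidable using (⌊_⌋)
open import Relation.Unary using (Pred; Decidable; ∁)
open import Relation.Unary.Properties using (∁?)

indicator-¬ : ∀ {p} {P : Set p} → ¬ P → (P? : Dec P) → (if ⌊ P? ⌋ then 1 else 0) ≡ 0
indicator-¬ ¬p (yes p) = contradiction p ¬p
indicator-¬ ¬p (no _)  = refl

module _ {a} {A : Set a} where

  sum-map-++ : ∀ (f : A → ℕ) xs ys → sum (map f (xs ++ ys)) ≡ sum (map f xs) + sum (map f ys)
  sum-map-++ f xs ys = trans (cong sum (map-++ f xs ys)) (sum-++ (map f xs) (map f ys))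

  sum-map-+ : ∀ (f g : A → ℕ) xs → sum (map (λ x → f x + g x) xs) ≡ sum (map f xs) + sum (map g xs)
  sum-map-+ f g []       = refl
  sum-map-+ f g (x ∷ xs) = trans (cong (f x + g x +_) (sum-map-+ f g xs)) (interchange (f x) (g x) _ _)

  sum-map-zero : ∀ (xs : List A) → sum (map (λ _ → 0) xs) ≡ 0
  sum-map-zero []       = refl
  sum-map-zero (_ ∷ xs) = sum-map-zero xs

  sum-map-cong-All : ∀ {f g : A → ℕ} {xs} → All (λ x → f x ≡ g x) xs → sum (map f xs) ≡ sum (map g xs)
  sum-map-cong-All []           = refl
  sum-map-cong-All (fx≡gx ∷ eqs) = cong₂ _+_ fx≡gx (sum-map-cong-All eqs)

  length-take-≤ : ∀ k (xs : List A) → k ≤ length xs → length (take k xs) ≡ k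
  length-take-≤ k xs k≤n = trans (length-take k xs) (m≤n⇒m⊓n≡m k≤n)

  length≤1-Unique-All≡ : ∀ {z} {zs : List A} → Unique zs → All (_≡ z) zs → length zs ≤ 1
  length≤1-Unique-All≡ _                 []                = z≤n
  length≤1-Unique-All≡ _                 (_ ∷ [])          = s≤s z≤n
  length≤1-Unique-All≡ ((x≢y ∷ _) ∷ _) (x≡z ∷ y≡z ∷ _) = contradiction (trans x≡z (sym y≡z)) x≢y

module _ {a p} {A : Set a} {P : Pred A p} (P? : Decidable P) where

  filter++filter∁↭ : ∀ xs → filter P? xs ++ filter (∁? P?) xs ↭ xs
  filter++filter∁↭ []       = ↭-refl
  filter++filter∁↭ (x ∷ xs) with P? x
  ... | yes _ = prep x (filter++filter∁↭ xs)
  ... | no  _ = ↭-trans (shift x (filter P? xs) _) (prep x (filter++filter∁↭ xs))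

  sum-indicator : ∀ xs → sum (map (λ x → if ⌊ P? x ⌋ then 1 else 0) xs) ≡ length (filter P? xs)
  sum-indicator []       = refl
  sum-indicator (x ∷ xs) with P? x
  ... | yes _ = cong suc (sum-indicator xs)
  ... | no  _ = sum-indicator xs

  takeWhile-++-stop : ∀ {xs y} → All P xs → ¬ P y → ∀ zs → takeWhile P? (xs ++ y ∷ zs) ≡ xs
  takeWhile-++-stop {y = y} [] ¬py zs with P? y
  ... | yes py = contradiction py ¬py
  ... | no  _  = refl
  takeWhile-++-stop {x ∷ _} (px ∷ pxs) ¬py zs with P? x
  ... | yes _   = cong (x ∷_) (takeWhile-++-stop pxs ¬py zs)
  ... | no  ¬px = contradiction px ¬px

module _ {a p} {A : Set a} {P : Pred A p} (P? : Decidable P) where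

  runs : List A → ℕ × ℕ
  runs xs = length (takeWhile P? xs) , length (takeWhile (∁? P?) xs)

  runs-P-block : ∀ {x xs y} → All P (x ∷ xs) → ¬ P y → ∀ zs → runs (x ∷ xs ++ y ∷ zs) ≡ (suc (length xs) , 0)
  runs-P-block (px ∷ pxs) ¬py zs =
    cong₂ _,_ (cong length (takeWhile-++-stop P? (px ∷ pxs) ¬py zs))
              (cong length (takeWhile-++-stop (∁? P?) [] (λ ¬px → ¬px px) _))

  runs-∁-block : ∀ {y ys x} → All (∁ P) (y ∷ ys) → P x → ∀ zs → runs (y ∷ ys ++ x ∷ zs) ≡ (0 , suc (length ys))
  runs-∁-block (¬py ∷ ¬pys) px zs =
    cong₂ _,_ (cong length (takeWhile-++-stop P? [] ¬py _))
              (cong length (takeWhile-++-stop (∁? P?) (¬py ∷ ¬pys) (λ ¬px → ¬px px) zs))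

module _ {a} {A : Set a} where

  insertAt : ℕ → List A → List A → List A
  insertAt k ys xs = take k xs ++ ys ++ drop k xs

  insertAt-↭ : ∀ k ys xs → insertAt k ys xs ↭ xs ++ ys
  insertAt-↭ k ys xs = begin
    take k xs ++ ys ++ drop k xs    ↭⟨ ++⁺ˡ (take k xs) (++-comm ys (drop k xs)) ⟩
    take k xs ++ drop k xs ++ ys    ≡⟨ ++-assoc (take k xs) (drop k xs) ys ⟨
    (take k xs ++ drop k xs) ++ ys  ≡⟨ cong (_++ ys) (take++drop≡id k xs) ⟩
    xs ++ ys                        ∎
    where open PermutationReasoning

  interleave : (xs ys : List A) → Fin (length xs) ⊎ Fin (length ys) → List A
  interleave xs ys (inj₁ k) = insertAt (suc (toℕ k)) ys xs
  interleave xs ys (inj₂ k) = insertAt (suc (toℕ k)) xs ys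

  interleave-↭ : ∀ xs ys c → interleave xs ys c ↭ xs ++ ys
  interleave-↭ xs ys (inj₁ k) = insertAt-↭ (suc (toℕ k)) ys xs
  interleave-↭ xs ys (inj₂ k) = ↭-trans (insertAt-↭ (suc (toℕ k)) xs ys) (++-comm ys xs)

runTag : ∀ {m n} → Fin m ⊎ Fin n → ℕ × ℕ
runTag (inj₁ k) = suc (toℕ k) , 0
runTag (inj₂ k) = 0 , suc (toℕ k)

runTag-injective : ∀ {m n} → Injective _≡_ _≡_ (runTag {m} {n})
runTag-injective {x = inj₁ _} {inj₁ _} eq = cong inj₁ (toℕ-injective (suc-injective (cong proj₁ eq)))
runTag-injective {x = inj₁ _} {inj₂ _} ()
runTag-injective {x = inj₂ _} {inj₁ _} ()
runTag-injective {x = inj₂ _} {inj₂ _} eq = cong inj₂ (toℕ-injective (suc-injective (cong proj₂ eq)))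

splitAt-injective : ∀ m {n} → Injective _≡_ _≡_ (splitAt m {n})
splitAt-injective m {n} {x} {y} eq =
  trans (sym (join-splitAt m n x)) (trans (cong (join m n) eq) (join-splitAt m n y))

module _ {a b p} {A : Set a} {B : Set b} (key : A → B) {P : Pred B p} (P? : Decidable P) where

  private
    map-insertAt-++ : ∀ k (ys xs : List A) zs →
                      map key (insertAt k ys xs) ++ zs ≡ map key (take k xs) ++ map key (ys ++ drop k xs) ++ zs
    map-insertAt-++ k ys xs zs =
      trans (cong (_++ zs) (map-++ key (take k xs) _)) (++-assoc (map key (take k xs)) _ zs)

    length-map-take : ∀ (xs : List A) (k : Fin (suc (length xs))) → length (map key (take (toℕ k) xs)) ≡ toℕ k
    length-map-take xs k = trans (length-map key (take (toℕ k) xs)) (length-take-≤ (toℕ k) xs (toℕ≤pred[n] k))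

  runs-map-interleave : ∀ {xs ys} → All (λ x → P (key x)) xs → All (λ y → ¬ P (key y)) ys →
                        0 < length xs → 0 < length ys →
                        ∀ c zs → runs P? (map key (interleave xs ys c) ++ zs) ≡ runTag c
  runs-map-interleave {x ∷ xs} {y ∷ ys} (px ∷ pxs) (¬py ∷ _) _ _ (inj₁ k) zs =
    trans (cong (runs P?) (map-insertAt-++ (suc (toℕ k)) (y ∷ ys) (x ∷ xs) zs))
          (trans (runs-P-block P? (All-map⁺ (px ∷ take⁺ (toℕ k) pxs)) ¬py _)
                 (cong (λ l → suc l , 0) (length-map-take xs k)))
  runs-map-interleave {x ∷ xs} {y ∷ ys} (px ∷ _) (¬py ∷ ¬pys) _ _ (inj₂ k) zs =
    trans (cong (runs P?) (map-insertAt-++ (suc (toℕ k)) (x ∷ xs) (y ∷ ys) zs))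
          (trans (runs-∁-block P? (All-map⁺ (¬py ∷ take⁺ (toℕ k) ¬pys)) px _)
                 (cong (λ l → 0 , suc l) (length-map-take ys k)))

module _ {a b} {A : Set a} {B : Set b} (_≟ᴮ_ : DecidableEquality B) (key : A → B) where

  count : B → List A → ℕ
  count y xs = sum (map (λ x → if ⌊ y ≟ᴮ key x ⌋ then 1 else 0) xs)

  count-++ : ∀ y xs xs′ → count y (xs ++ xs′) ≡ count y xs + count y xs′
  count-++ y = sum-map-++ (λ x → if ⌊ y ≟ᴮ key x ⌋ then 1 else 0)

  count≡length-filter : ∀ y xs → count y xs ≡ length (filter (λ x → y ≟ᴮ key x) xs)
  count≡length-filter y = sum-indicator (λ x → y ≟ᴮ key x)

  count≤length-filter-≢ : ∀ {y z} → z ≢ y → ∀ xs → count y xs ≤ length (filter (∁? (λ x → z ≟ᴮ key x)) xs)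
  count≤length-filter-≢ {y} {z} z≢y xs = begin
    count y xs                                   ≡⟨ count≡length-filter y xs ⟩
    length (filter (λ x → y ≟ᴮ key x) xs)        ≤⟨ Sublist.length-mono-≤ (Sublist.filter⁺ _ _ y≡⇒z≢ (⊆-refl {x = xs})) ⟩
    length (filter (∁? (λ x → z ≟ᴮ key x)) xs)   ∎
    where
    open ≤-Reasoning
    y≡⇒z≢ : ∀ {x x′} → x ≡ x′ → y ≡ key x → z ≢ key x′
    y≡⇒z≢ refl y≡kx z≡kx = z≢y (trans z≡kx (sym y≡kx))

  sum-count≤length : ∀ {ys} → Unique ys → ∀ xs → sum (map (λ y → count y xs) ys) ≤ length xs
  sum-count≤length {ys} _ [] = ≤-reflexive (sum-map-zero ys)
  sum-count≤length {ys} u (x ∷ xs) = begin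
    sum (map (λ y → ind y + count y xs) ys)             ≡⟨ sum-map-+ ind (λ y → count y xs) ys ⟩
    sum (map ind ys) + sum (map (λ y → count y xs) ys)  ≤⟨ +-mono-≤ ind-sum≤1 (sum-count≤length u xs) ⟩
    suc (length xs)                                     ∎
    where
    open ≤-Reasoning
    ind : B → ℕ
    ind y = if ⌊ y ≟ᴮ key x ⌋ then 1 else 0
    ind-sum≤1 : sum (map ind ys) ≤ 1
    ind-sum≤1 = ≤-trans (≤-reflexive (sum-indicator (_≟ᴮ key x) ys))
      (length≤1-Unique-All≡ (Unique.filter⁺ (_≟ᴮ key x) u) (all-filter (_≟ᴮ key x) ys))

module _ {Sig : Signature} where

  -- g(□, u₁, …, u_width), the hole being g's first argument
  record Piece : Set where
    constructor piece
    field
      symbol   : Fin (S Sig)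
      {width}  : ℕ
      arity≡   : suc width ≡ arity Sig symbol
      siblings : Vec (Term Sig) width
  open Piece public

  plug : Piece → Term Sig → Term Sig
  plug (piece g e us) t = app g (subst (Vec (Term Sig)) e (t ∷ us))

  leftComb : Term Sig → List Piece → Term Sig
  leftComb = foldr plug

  mutual
    spine : Term Sig → List (Fin (S Sig))
    spine (app g ts) = g ∷ spineOfFirst ts

    spineOfFirst : ∀ {k} → Vec (Term Sig) k → List (Fin (S Sig))
    spineOfFirst []      = []
    spineOfFirst (t ∷ _) = spine t

  spineOfFirst-subst : ∀ {k l} (e : suc k ≡ l) t (us : Vec (Term Sig) k) →
                       spineOfFirst (subst (Vec (Term Sig)) e (t ∷ us)) ≡ spine t
  spineOfFirst-subst refl t us = refl

  spine-leftComb : ∀ b ps → spine (leftComb b ps) ≡ map symbol ps ++ spine b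
  spine-leftComb b []                  = refl
  spine-leftComb b (piece g e us ∷ ps) =
    cong (g ∷_) (trans (spineOfFirst-subst e (leftComb b ps) us) (spine-leftComb b ps))

  occs-subst : ∀ j {k l} (e : k ≡ l) (ts : Vec (Term Sig) k) → occs j (subst (Vec (Term Sig)) e ts) ≡ occs j ts
  occs-subst j refl ts = refl

  pieceOcc : Fin (S Sig) → Piece → ℕ
  pieceOcc j (piece g e us) = (if ⌊ j ≟ g ⌋ then 1 else 0) + occs j us

  piecesOcc : Fin (S Sig) → List Piece → ℕ
  piecesOcc j ps = sum (map (pieceOcc j) ps)

  occ-plug : ∀ j p t → occ j (plug p t) ≡ pieceOcc j p + occ j t
  occ-plug j (piece g e us) t =
    trans (cong (ind +_) (occs-subst j e (t ∷ us))) (x∙yz≈xz∙y ind (occ j t) (occs j us))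
    where
    ind : ℕ
    ind = if ⌊ j ≟ g ⌋ then 1 else 0

  occ-leftComb : ∀ j b ps → occ j (leftComb b ps) ≡ occ j b + piecesOcc j ps
  occ-leftComb j b []       = sym (+-identityʳ (occ j b))
  occ-leftComb j b (p ∷ ps) = begin
    occ j (plug p (leftComb b ps))             ≡⟨ occ-plug j p (leftComb b ps) ⟩
    pieceOcc j p + occ j (leftComb b ps)       ≡⟨ cong (pieceOcc j p +_) (occ-leftComb j b ps) ⟩
    pieceOcc j p + (occ j b + piecesOcc j ps)  ≡⟨ x∙yz≈y∙xz (pieceOcc j p) (occ j b) (piecesOcc j ps) ⟩
    occ j b + piecesOcc j (p ∷ ps)             ∎
    where open ≡-Reasoning

  occ-leftComb-↭ : ∀ j b {ps qs} → ps ↭ qs → occ j (leftComb b ps) ≡ occ j (leftComb b qs)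
  occ-leftComb-↭ j b {ps} {qs} ps↭qs = begin
    occ j (leftComb b ps)      ≡⟨ occ-leftComb j b ps ⟩
    occ j b + piecesOcc j ps   ≡⟨ cong (occ j b +_) (sum-↭ (map⁺ (pieceOcc j) ps↭qs)) ⟩
    occ j b + piecesOcc j qs   ≡⟨ occ-leftComb j b qs ⟨
    occ j (leftComb b qs)      ∎
    where open ≡-Reasoning

  mutual
    flatten : Term Sig → Term Sig × List Piece
    flatten (app g ts) = flattenApp g refl ts

    flattenApp : ∀ g {k} → k ≡ arity Sig g → Vec (Term Sig) k → Term Sig × List Piece
    flattenApp g e []       = app g (subst (Vec (Term Sig)) e []) , []
    flattenApp g e (t ∷ ts) =
      proj₁ (flatten t) , piece g e (proj₁ (flattenArgs ts)) ∷ proj₂ (flatten t) ++ proj₂ (flattenArgs ts)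

    flattenArgs : ∀ {k} → Vec (Term Sig) k → Vec (Term Sig) k × List Piece
    flattenArgs []       = [] , []
    flattenArgs (t ∷ ts) =
      proj₁ (flatten t) ∷ proj₁ (flattenArgs ts) , proj₂ (flatten t) ++ proj₂ (flattenArgs ts)

  base : Term Sig → Term Sig
  base = proj₁ ∘ flatten

  pieces : Term Sig → List Piece
  pieces = proj₂ ∘ flatten

  private
    rearrange : ∀ i a p s q → i + ((a + p) + (s + q)) ≡ a + ((i + s) + (p + q))
    rearrange = solve-∀

  mutual
    occ-flatten : ∀ j t → occ j t ≡ occ j (base t) + piecesOcc j (pieces t)
    occ-flatten j (app g ts) = occ-flattenApp j g refl ts

    occ-flattenApp : ∀ j g {k} (e : k ≡ arity Sig g) ts →
                     occ j (app g (subst (Vec (Term Sig)) e ts))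
                       ≡ occ j (proj₁ (flattenApp g e ts)) + piecesOcc j (proj₂ (flattenApp g e ts))
    occ-flattenApp j g e []       = sym (+-identityʳ _)
    occ-flattenApp j g e (t ∷ ts) = begin
      ind + occs j (subst (Vec (Term Sig)) e (t ∷ ts))
        ≡⟨ cong (ind +_) (occs-subst j e (t ∷ ts)) ⟩
      ind + (occ j t + occs j ts)
        ≡⟨ cong (ind +_) (cong₂ _+_ (occ-flatten j t) (occs-flattenArgs j ts)) ⟩
      ind + ((occ j b + piecesOcc j ps) + (occs j bs + piecesOcc j qs))
        ≡⟨ rearrange ind (occ j b) (piecesOcc j ps) (occs j bs) (piecesOcc j qs) ⟩
      occ j b + ((ind + occs j bs) + (piecesOcc j ps + piecesOcc j qs))
        ≡⟨ cong (λ m → occ j b + ((ind + occs j bs) + m)) (sum-map-++ (pieceOcc j) ps qs) ⟨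
      occ j b + piecesOcc j (piece g e bs ∷ ps ++ qs)
        ∎
      where
      open ≡-Reasoning
      ind = if ⌊ j ≟ g ⌋ then 1 else 0
      b   = base t
      ps  = pieces t
      bs  = proj₁ (flattenArgs ts)
      qs  = proj₂ (flattenArgs ts)

    occs-flattenArgs : ∀ j {k} (ts : Vec (Term Sig) k) →
                       occs j ts ≡ occs j (proj₁ (flattenArgs ts)) + piecesOcc j (proj₂ (flattenArgs ts))
    occs-flattenArgs j []       = refl
    occs-flattenArgs j (t ∷ ts) = begin
      occ j t + occs j ts
        ≡⟨ cong₂ _+_ (occ-flatten j t) (occs-flattenArgs j ts) ⟩
      (occ j b + piecesOcc j ps) + (occs j bs + piecesOcc j qs)
        ≡⟨ interchange (occ j b) (piecesOcc j ps) (occs j bs) (piecesOcc j qs) ⟩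
      (occ j b + occs j bs) + (piecesOcc j ps + piecesOcc j qs)
        ≡⟨ cong ((occ j b + occs j bs) +_) (sum-map-++ (pieceOcc j) ps qs) ⟨
      occs j (b ∷ bs) + piecesOcc j (ps ++ qs)
        ∎
      where
      open ≡-Reasoning
      b  = base t
      ps = pieces t
      bs = proj₁ (flattenArgs ts)
      qs = proj₂ (flattenArgs ts)

  mutual
    occ≡count : ∀ {j} → 0 < arity Sig j → ∀ t → occ j t ≡ count _≟_ symbol j (pieces t)
    occ≡count 0<arⱼ (app g ts) = occ≡countApp 0<arⱼ g refl ts

    occ≡countApp : ∀ {j} → 0 < arity Sig j → ∀ g {k} (e : k ≡ arity Sig g) ts →
                   occ j (app g (subst (Vec (Term Sig)) e ts)) ≡ count _≟_ symbol j (proj₂ (flattenApp g e ts))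
    occ≡countApp {j} 0<arⱼ g e [] = begin
      ind + occs j (subst (Vec (Term Sig)) e []) ≡⟨ cong (ind +_) (occs-subst j e []) ⟩
      ind + 0                                    ≡⟨ +-identityʳ ind ⟩
      ind                                        ≡⟨ indicator-¬ j≢g (j ≟ g) ⟩
      0                                          ∎
      where
      open ≡-Reasoning
      ind = if ⌊ j ≟ g ⌋ then 1 else 0
      j≢g : j ≢ g
      j≢g refl = <⇒≢ 0<arⱼ e
    occ≡countApp {j} 0<arⱼ g e (t ∷ ts) = begin
      ind + occs j (subst (Vec (Term Sig)) e (t ∷ ts))        ≡⟨ cong (ind +_) (occs-subst j e (t ∷ ts)) ⟩
      ind + (occ j t + occs j ts)                             ≡⟨ cong (ind +_) (occs≡count 0<arⱼ (t ∷ ts)) ⟩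
      ind + count _≟_ symbol j (proj₂ (flattenArgs (t ∷ ts))) ∎
      where
      open ≡-Reasoning
      ind = if ⌊ j ≟ g ⌋ then 1 else 0

    occs≡count : ∀ {j} → 0 < arity Sig j → ∀ {k} (ts : Vec (Term Sig) k) →
                 occs j ts ≡ count _≟_ symbol j (proj₂ (flattenArgs ts))
    occs≡count 0<arⱼ []       = refl
    occs≡count {j} 0<arⱼ (t ∷ ts) =
      trans (cong₂ _+_ (occ≡count 0<arⱼ t) (occs≡count 0<arⱼ ts))
            (sym (count-++ _≟_ symbol j (pieces t) (proj₂ (flattenArgs ts))))

  leftComb-interleave-injective : ∀ {i} b {I Q : List Piece} →
    All (λ p → i ≡ symbol p) I → All (λ p → i ≢ symbol p) Q → 0 < length I → 0 < length Q →
    Injective _≡_ _≡_ (leftComb b ∘ interleave I Q)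
  leftComb-interleave-injective {i} b {I} {Q} allI allQ 0<#I 0<#Q {c} {c′} eq = runTag-injective (begin
    runTag c                                              ≡⟨ runs-spine c ⟨
    runs (i ≟_) (spine (leftComb b (interleave I Q c)))   ≡⟨ cong (runs (i ≟_) ∘ spine) eq ⟩
    runs (i ≟_) (spine (leftComb b (interleave I Q c′)))  ≡⟨ runs-spine c′ ⟩
    runTag c′                                             ∎)
    where
    open ≡-Reasoning
    runs-spine : ∀ c → runs (i ≟_) (spine (leftComb b (interleave I Q c))) ≡ runTag c
    runs-spine c = trans (cong (runs (i ≟_)) (spine-leftComb b (interleave I Q c)))
                         (runs-map-interleave symbol (i ≟_) allI allQ 0<#I 0<#Q c (spine b))

  injective-rearrangements : ∀ {i j N} (t : Term Sig) → i ≢ j → 0 < arity Sig i → 0 < arity Sig j →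
    0 < occ i t → 0 < occ j t → N ≤ length (pieces t) →
    Σ[ f ∈ (Fin N → Term Sig) ] (Injective _≡_ _≡_ f × ∀ k g → occ g (f k) ≡ occ g t)
  injective-rearrangements {i} {j} {N} t i≢j 0<arᵢ 0<arⱼ 0<occᵢ 0<occⱼ N≤#ps =
    comb ∘ index , (λ eq → index-injective (comb-injective eq)) , contents
    where
    ps = pieces t
    isI = λ p → i ≟ symbol p
    I = filter isI ps
    Q = filter (∁? isI) ps
    I++Q↭ps = filter++filter∁↭ isI ps

    0<#I : 0 < length I
    0<#I = ≤-trans 0<occᵢ (≤-reflexive (trans (occ≡count 0<arᵢ t) (count≡length-filter _≟_ symbol i ps)))

    0<#Q : 0 < length Q
    0<#Q = ≤-trans 0<occⱼ (≤-trans (≤-reflexive (occ≡count 0<arⱼ t)) (count≤length-filter-≢ _≟_ symbol i≢j ps))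

    N≤#I+#Q : N ≤ length I + length Q
    N≤#I+#Q = ≤-trans N≤#ps (≤-reflexive (trans (sym (↭-length I++Q↭ps)) (length-++ I)))

    index : Fin N → Fin (length I) ⊎ Fin (length Q)
    index k = splitAt (length I) (inject≤ k N≤#I+#Q)

    index-injective : Injective _≡_ _≡_ index
    index-injective eq = inject≤-injective _ _ _ _ (splitAt-injective (length I) eq)

    comb : Fin (length I) ⊎ Fin (length Q) → Term Sig
    comb = leftComb (base t) ∘ interleave I Q

    comb-injective : Injective _≡_ _≡_ comb
    comb-injective =
      leftComb-interleave-injective (base t) (all-filter isI ps) (all-filter (∁? isI) ps) 0<#I 0<#Q

    contents : ∀ k g → occ g (comb (index k)) ≡ occ g t
    contents k g = begin
      occ g (leftComb (base t) (interleave I Q (index k)))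
        ≡⟨ occ-leftComb-↭ g (base t) (↭-trans (interleave-↭ I Q (index k)) I++Q↭ps) ⟩
      occ g (leftComb (base t) ps)
        ≡⟨ occ-leftComb g (base t) ps ⟩
      occ g (base t) + piecesOcc g ps
        ≡⟨ occ-flatten g t ⟨
      occ g t
        ∎
      where open ≡-Reasoning

nonconstant : ∀ Sig {g} → toℕ g < F Sig → 0 < arity Sig g
nonconstant Sig {g} g<F with toℕ g <? B Sig
... | yes g<B = ≤-trans (s≤s z≤n) (ar-big Sig g g<B)
... | no  g≮B = ≤-reflexive (sym (ar-unary Sig g (≮⇒≥ g≮B) g<F))

sumNonConst≤length-pieces : ∀ {Sig} {t : Term Sig} {n} → HasContents t n → sumNonConst Sig n ≤ length (pieces t)
sumNonConst≤length-pieces {Sig} {t} {n} t∶n = begin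
  sum (map n nonConst)
    ≡⟨ sum-map-cong-All (All.map n≡count (all-filter isNonConst (allFin (S Sig)))) ⟩
  sum (map (λ g → count _≟_ symbol g (pieces t)) nonConst)
    ≤⟨ sum-count≤length _≟_ symbol unique (pieces t) ⟩
  length (pieces t)
    ∎
  where
  open ≤-Reasoning
  isNonConst = λ (g : Fin (S Sig)) → toℕ g <? F Sig
  nonConst = filter isNonConst (allFin (S Sig))
  unique : Unique nonConst
  unique = Unique.filter⁺ isNonConst (Unique.allFin⁺ (S Sig))
  n≡count : ∀ {g} → toℕ g < F Sig → n g ≡ count _≟_ symbol g (pieces t)
  n≡count {g} g<F = trans (sym (t∶n g)) (occ≡count (nonconstant Sig g<F) t)

lemma14 : (Sig : Signature) (x N : ℕ) (n : Fin (S Sig) → ℕ)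
    → (∃[ t ] (weight {Sig} t ≡ x × HasContents t n))
    → N ≤ sumNonConst Sig n
    → (∃[ i ] ∃[ j ] (i ≢ j
         × (B Sig ≤ toℕ i × toℕ i < F Sig × 0 < n i)
         × (B Sig ≤ toℕ j × toℕ j < F Sig × 0 < n j)))
    → Σ[ f ∈ (Fin N → Term Sig) ] (Injective _≡_ _≡_ f × (∀ k → HasContents (f k) n))
lemma14 Sig _ N n (t , _ , t∶n) N≤Σn (i , j , i≢j , (_ , i<F , 0<nᵢ) , (_ , j<F , 0<nⱼ)) =
  let f , f-injective , f-occ =
        injective-rearrangements t i≢j (nonconstant Sig i<F) (nonconstant Sig j<F) (occurs i 0<nᵢ) (occurs j 0<nⱼ)
                                 (≤-trans N≤Σn (sumNonConst≤length-pieces {t = t} t∶n))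
  in f , f-injective , λ k g → trans (f-occ k g) (t∶n g)
  where
  occurs : ∀ g → 0 < n g → 0 < occ g t
  occurs g = subst (0 <_) (sym (t∶n g))
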